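{- $WQT^*$ is an extension of $WQT$: every axiom (hence every theorem) of $WQT$ is provable in $WQT^*$.
   Context: Let $\mathcal{L}_T=\{0,(\cdot,\cdot),\sqsubseteq\}$. To each variable-free $\mathcal{L}_T$-term $v$ associate a term $v^\tau$ of the language $\{a,b,*,\sqsubseteq^*\}$ by $0^\tau\equiv a$, $(u,v)^\tau\equiv b*(u^\tau*v^\tau)$; $\Sigma^\tau$ is the set of all such $v^\tau$. $WQT$ is the theory in $\{a,b,*,\sqsubseteq^*\}$ with axioms: (WQT1) $\neg(s=t)$ for distinct $s,t\in\Sigma^\tau$; (WQT2) $\forall z\,(z\sqsubseteq^* b*(s*t)\leftrightarrow z=b*(s*t)\vee z\sqsubseteq^* s\vee z\sqsubseteq^* t)$ for all $s,t\in\Sigma^\tau$; (WQT3) $\forall z\,(z\sqsubseteq^* a\leftrightarrow z=a)$. $WQT^*$ is the theory in the same language with the following axioms, where $t$ ranges over all variable-free terms, $xBy\equiv\exists z\,(y=x*z)$, $xEy\equiv\exists z\,(y=z*x)$, $x\subseteq_p y\equiv x=y\vee xBy\vee xEy\vee\exists z_1,z_2\,(y=z_1*(x*z_2))\vee\exists z_1,z_2\,(y=(z_1*x)*z_2)$: (WQT*1) $\forall x,y,z\,(x*(y*z)\subseteq_p t\vee(x*y)*z\subseteq_p t\to x*(y*z)=(x*y)*z)$; (WQT*2) $\forall x,y\,(x*y\subseteq_p t\to\neg(x*y=a)\wedge\neg(x*y=b))$; (WQT*3) $\forall x,y\,((a*x\subseteq_p t\wedge a*y\subseteq_p t\to(a*x=a*y\to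 x=y))\wedge(b*x\subseteq_p t\wedge b*y\subseteq_p t\to(b*x=b*y\to x=y))\wedge(x*a\subseteq_p t\wedge y*a\subseteq_p t\to(x*a=y*a\to x=y))\wedge(x*b\subseteq_p t\wedge y*b\subseteq_p t\to(x*b=y*b\to x=y)))$; (WQT*4) $\forall x,y\,((a*x\subseteq_p t\wedge b*y\subseteq_p t\to\neg(a*x=b*y))\wedge(x*a\subseteq_p t\wedge y*b\subseteq_p t\to\neg(x*a=y*b)))$; (WQT*5) $\forall x\,(x\subseteq_p t\to(x=a\vee x=b\vee((aBx\vee bBx)\wedge(aEx\vee bEx))))$; (WQT*6) $\forall y,z\,(b*(y*z)\subseteq_p t\to\forall x\,(x\sqsubseteq^* b*(y*z)\leftrightarrow x=b*(y*z)\vee x\sqsubseteq^* y\vee x\sqsubseteq^* z))$; (WQT*7) $\forall z\,(z\sqsubseteq^* a\leftrightarrow z=a)$; (WQT*8) $\forall x,y\,(x\sqsubseteq^* y\wedge y\sqsubseteq^* x\to x=y)$; (WQT*9) $\forall x,y,z\,(x\sqsubseteq^* y\wedge y\sqsubseteq^* z\to x\sqsubseteq^* z)$. -}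

module Defs where

open import Data.Nat using (ℕ; zero; suc)
open import Data.Fin using (Fin; zero; suc)
open import Data.List using (List; []; _∷_; map)
open import Data.List.Membership.Propositional using (_∈_)
open import Relation.Binary.PropositionalEquality using (_≡_)
open import Relation.Nullary using (¬_)
open import Data.Product using (_×_)

-- First-order syntax of the language {a, b, *, ⊑*}
-- Terms / formulas with n free variables (de Bruijn indices; var zero is
-- the most recently bound variable).

infixl 7 _∙_
data Term (n : ℕ) : Set where
  var : Fin n → Term n
  a   : Term n
  b   : Term n
  _∙_ : Term n → Term n → Term n

infix  5 _≐_ _⊑_
infixr 4 _∧'_
infixr 3 _∨'_
infixr 2 _⇒_
data Formula (n : ℕ) : Set where
  ⊥'   : Formula n
  _≐_  : Term n → Term n → Formula n
  _⊑_  : Term n → Term n → Formula n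
  _⇒_  : Formula n → Formula n → Formula n
  _∧'_ : Formula n → Formula n → Formula n
  _∨'_ : Formula n → Formula n → Formula n
  ∀'   : Formula (suc n) → Formula n
  ∃'   : Formula (suc n) → Formula n

¬' : ∀ {n} → Formula n → Formula n
¬' φ = φ ⇒ ⊥'

infix 1 _⇔_
_⇔_ : ∀ {n} → Formula n → Formula n → Formula n
φ ⇔ ψ = (φ ⇒ ψ) ∧' (ψ ⇒ φ)

ext : ∀ {n m} → (Fin n → Fin m) → Fin (suc n) → Fin (suc m)
ext ρ zero    = zero
ext ρ (suc i) = suc (ρ i)

renT : ∀ {n m} → (Fin n → Fin m) → Term n → Term m
renT ρ (var i) = var (ρ i)
renT ρ a       = a
renT ρ b       = b
renT ρ (s ∙ t) = renT ρ s ∙ renT ρ t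

renF : ∀ {n m} → (Fin n → Fin m) → Formula n → Formula m
renF ρ ⊥'       = ⊥'
renF ρ (s ≐ t)  = renT ρ s ≐ renT ρ t
renF ρ (s ⊑ t)  = renT ρ s ⊑ renT ρ t
renF ρ (φ ⇒ ψ)  = renF ρ φ ⇒ renF ρ ψ
renF ρ (φ ∧' ψ) = renF ρ φ ∧' renF ρ ψ
renF ρ (φ ∨' ψ) = renF ρ φ ∨' renF ρ ψ
renF ρ (∀' φ)   = ∀' (renF (ext ρ) φ)
renF ρ (∃' φ)   = ∃' (renF (ext ρ) φ)

wkT : ∀ {n} → Term n → Term (suc n)
wkT = renT suc

wkF : ∀ {n} → Formula n → Formula (suc n)
wkF = renF suc

noVar : ∀ {n} → Fin 0 → Fin n
noVar ()

cl : ∀ {n} → Term 0 → Term n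
cl = renT noVar

clF : ∀ {n} → Formula 0 → Formula n
clF = renF noVar

exts : ∀ {n m} → (Fin n → Term m) → Fin (suc n) → Term (suc m)
exts σ zero    = var zero
exts σ (suc i) = wkT (σ i)

subT : ∀ {n m} → (Fin n → Term m) → Term n → Term m
subT σ (var i) = σ i
subT σ a       = a
subT σ b       = b
subT σ (s ∙ t) = subT σ s ∙ subT σ t

subF : ∀ {n m} → (Fin n → Term m) → Formula n → Formula m
subF σ ⊥'       = ⊥'
subF σ (s ≐ t)  = subT σ s ≐ subT σ t
subF σ (s ⊑ t)  = subT σ s ⊑ subT σ t
subF σ (φ ⇒ ψ)  = subF σ φ ⇒ subF σ ψ
subF σ (φ ∧' ψ) = subF σ φ ∧' subF σ ψ
subF σ (φ ∨' ψ) = subF σ φ ∨' subF σ ψ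
subF σ (∀' φ)   = ∀' (subF (exts σ) φ)
subF σ (∃' φ)   = ∃' (subF (exts σ) φ)

single : ∀ {n} → Term n → Fin (suc n) → Term n
single t zero    = t
single t (suc i) = var i

_[_] : ∀ {n} → Formula (suc n) → Term n → Formula n
φ [ t ] = subF (single t) φ

Theory : Set₁
Theory = Formula 0 → Set

infix 0 _⊢_∣_
data _⊢_∣_ (T : Theory) {n : ℕ} : List (Formula n) → Formula n → Set where
  hyp   : ∀ {Γ φ} → φ ∈ Γ → T ⊢ Γ ∣ φ
  ax    : ∀ {Γ} {ψ : Formula 0} → T ψ → T ⊢ Γ ∣ clF ψ
  raa   : ∀ {Γ φ} → T ⊢ (¬' φ ∷ Γ) ∣ ⊥' → T ⊢ Γ ∣ φ
  ⇒I    : ∀ {Γ φ ψ} → T ⊢ (φ ∷ Γ) ∣ ψ → T ⊢ Γ ∣ φ ⇒ ψ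
  ⇒E    : ∀ {Γ φ ψ} → T ⊢ Γ ∣ φ ⇒ ψ → T ⊢ Γ ∣ φ → T ⊢ Γ ∣ ψ
  ∧I    : ∀ {Γ φ ψ} → T ⊢ Γ ∣ φ → T ⊢ Γ ∣ ψ → T ⊢ Γ ∣ φ ∧' ψ
  ∧E₁   : ∀ {Γ φ ψ} → T ⊢ Γ ∣ φ ∧' ψ → T ⊢ Γ ∣ φ
  ∧E₂   : ∀ {Γ φ ψ} → T ⊢ Γ ∣ φ ∧' ψ → T ⊢ Γ ∣ ψ
  ∨I₁   : ∀ {Γ φ ψ} → T ⊢ Γ ∣ φ → T ⊢ Γ ∣ φ ∨' ψ
  ∨I₂   : ∀ {Γ φ ψ} → T ⊢ Γ ∣ ψ → T ⊢ Γ ∣ φ ∨' ψ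
  ∨E    : ∀ {Γ φ ψ χ} → T ⊢ Γ ∣ φ ∨' ψ → T ⊢ (φ ∷ Γ) ∣ χ → T ⊢ (ψ ∷ Γ) ∣ χ
          → T ⊢ Γ ∣ χ
  ∀I    : ∀ {Γ φ} → T ⊢ map wkF Γ ∣ φ → T ⊢ Γ ∣ ∀' φ
  ∀E    : ∀ {Γ φ} → T ⊢ Γ ∣ ∀' φ → (t : Term n) → T ⊢ Γ ∣ φ [ t ]
  ∃I    : ∀ {Γ φ} (t : Term n) → T ⊢ Γ ∣ φ [ t ] → T ⊢ Γ ∣ ∃' φ
  ∃E    : ∀ {Γ φ ψ} → T ⊢ Γ ∣ ∃' φ → T ⊢ (φ ∷ map wkF Γ) ∣ wkF ψ → T ⊢ Γ ∣ ψ
  ≐refl : ∀ {Γ} (t : Term n) → T ⊢ Γ ∣ t ≐ t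
  ≐subst : ∀ {Γ s t} (φ : Formula (suc n)) → T ⊢ Γ ∣ s ≐ t → T ⊢ Γ ∣ φ [ s ]
           → T ⊢ Γ ∣ φ [ t ]

Provable : Theory → Formula 0 → Set
Provable T φ = T ⊢ [] ∣ φ

-- The translation τ of variable-free L_T terms

data LTerm : Set where
  𝟎    : LTerm
  pair : LTerm → LTerm → LTerm

τ : LTerm → Term 0
τ 𝟎          = a
τ (pair u v) = b ∙ (τ u ∙ τ v)

data WQT : Theory where
  wqt1 : (u v : LTerm) → ¬ (τ u ≡ τ v) → WQT (¬' (τ u ≐ τ v))
  wqt2 : (u v : LTerm) →
         WQT (∀' (var zero ⊑ b ∙ (cl (τ u) ∙ cl (τ v))
                  ⇔ (var zero ≐ b ∙ (cl (τ u) ∙ cl (τ v)))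
                    ∨' (var zero ⊑ cl (τ u))
                    ∨' (var zero ⊑ cl (τ v))))
  wqt3 : WQT (∀' (var zero ⊑ a ⇔ var zero ≐ a))

B' : ∀ {n} → Term n → Term n → Formula n
B' x y = ∃' (wkT y ≐ wkT x ∙ var zero)

E' : ∀ {n} → Term n → Term n → Formula n
E' x y = ∃' (wkT y ≐ var zero ∙ wkT x)

infix 5 _⊆p_
_⊆p_ : ∀ {n} → Term n → Term n → Formula n
x ⊆p y =
  (x ≐ y) ∨' B' x y ∨' E' x y
  ∨' ∃' (∃' (wkT (wkT y) ≐ var (suc zero) ∙ (wkT (wkT x) ∙ var zero)))
  ∨' ∃' (∃' (wkT (wkT y) ≐ (var (suc zero) ∙ wkT (wkT x)) ∙ var zero))

-- variables in context of 3 quantifiers ∀x ∀y ∀z: x = #2, y = #1, z = #0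
private
  v0 : ∀ {n} → Term (suc n)
  v0 = var zero
  v1 : ∀ {n} → Term (suc (suc n))
  v1 = var (suc zero)
  v2 : ∀ {n} → Term (suc (suc (suc n)))
  v2 = var (suc (suc zero))

data WQT* : Theory where
  wqt*1 : (t : Term 0) →
    WQT* (∀' (∀' (∀' ((v2 ∙ (v1 ∙ v0) ⊆p cl t) ∨' ((v2 ∙ v1) ∙ v0 ⊆p cl t)
                      ⇒ v2 ∙ (v1 ∙ v0) ≐ (v2 ∙ v1) ∙ v0))))
  wqt*2 : (t : Term 0) →
    WQT* (∀' (∀' ((v1 ∙ v0 ⊆p cl t) ⇒ ¬' (v1 ∙ v0 ≐ a) ∧' ¬' (v1 ∙ v0 ≐ b))))
  wqt*3 : (t : Term 0) →
    WQT* (∀' (∀' (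
      ((a ∙ v1 ⊆p cl t) ∧' (a ∙ v0 ⊆p cl t) ⇒ (a ∙ v1 ≐ a ∙ v0 ⇒ v1 ≐ v0))
      ∧' ((b ∙ v1 ⊆p cl t) ∧' (b ∙ v0 ⊆p cl t) ⇒ (b ∙ v1 ≐ b ∙ v0 ⇒ v1 ≐ v0))
      ∧' ((v1 ∙ a ⊆p cl t) ∧' (v0 ∙ a ⊆p cl t) ⇒ (v1 ∙ a ≐ v0 ∙ a ⇒ v1 ≐ v0))
      ∧' ((v1 ∙ b ⊆p cl t) ∧' (v0 ∙ b ⊆p cl t) ⇒ (v1 ∙ b ≐ v0 ∙ b ⇒ v1 ≐ v0)))))
  wqt*4 : (t : Term 0) →
    WQT* (∀' (∀' (
      ((a ∙ v1 ⊆p cl t) ∧' (b ∙ v0 ⊆p cl t) ⇒ ¬' (a ∙ v1 ≐ b ∙ v0))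
      ∧' ((v1 ∙ a ⊆p cl t) ∧' (v0 ∙ b ⊆p cl t) ⇒ ¬' (v1 ∙ a ≐ v0 ∙ b)))))
  wqt*5 : (t : Term 0) →
    WQT* (∀' ((v0 ⊆p cl t) ⇒
      (v0 ≐ a) ∨' (v0 ≐ b) ∨' ((B' a v0 ∨' B' b v0) ∧' (E' a v0 ∨' E' b v0))))
  -- ∀y,z (b*(y*z) ⊆p t → ∀x (x ⊑* b*(y*z) ↔ x = b*(y*z) ∨ x ⊑* y ∨ x ⊑* z))
  -- outside: y = #1, z = #0 ; inside ∀x: x = #0, y = #2, z = #1
  wqt*6 : (t : Term 0) →
    WQT* (∀' (∀' ((b ∙ (v1 ∙ v0) ⊆p cl t) ⇒
      ∀' (v0 ⊑ b ∙ (v2 ∙ v1) ⇔ (v0 ≐ b ∙ (v2 ∙ v1)) ∨' (v0 ⊑ v2) ∨' (v0 ⊑ v1)))))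
  wqt*7 : WQT* (∀' (v0 ⊑ a ⇔ v0 ≐ a))
  wqt*8 : WQT* (∀' (∀' ((v1 ⊑ v0) ∧' (v0 ⊑ v1) ⇒ v1 ≐ v0)))
  wqt*9 : WQT* (∀' (∀' (∀' ((v2 ⊑ v1) ∧' (v1 ⊑ v0) ⇒ v2 ⊑ v0))))

module Submission where

open import Defs
open import Data.Empty using (⊥-elim)
open import Data.Fin using (Fin; zero; suc)
open import Data.List using (List; []; _∷_; _++_)
open import Data.List.NonEmpty using (List⁺; _∷_; _∷⁺_; _⁺++⁺_; toList)
open import Data.List.Properties using (∷-injectiveʳ; ++-assoc; ++-identityʳ)
open import Data.List.Relation.Unary.Any using (here)
open import Data.Nat using (ℕ; suc)
open import Data.Product using (_×_; _,_; proj₁)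
open import Function using (_∘_)
open import Relation.Binary.PropositionalEquality
  using (_≡_; _≢_; refl; sym; trans; cong; cong₂; subst; subst₂)

-- WQT3 is literally WQT*7, and each instance of WQT2 is the instance of WQT*6 at the
-- closed term t = b*(τu*τv), which is a part of itself. For WQT1, the instances of
-- WQT*1 prove every closed term equal to its right-bracketed word over {a, b}, and the
-- instances of WQT*2-4 refute the equality of two distinct words letter by letter;
-- distinct L_T-terms have distinct τ-words because these words form a prefix code.

renT-id : ∀ {n} {ρ : Fin n → Fin n} → (∀ i → ρ i ≡ i) → ∀ t → renT ρ t ≡ t
renT-id ρ≗id (var i) = cong var (ρ≗id i)
renT-id ρ≗id a       = refl
renT-id ρ≗id b       = refl
renT-id ρ≗id (s ∙ t) = cong₂ _∙_ (renT-id ρ≗id s) (renT-id ρ≗id t)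

ext-id : ∀ {n} {ρ : Fin n → Fin n} → (∀ i → ρ i ≡ i) → ∀ i → ext ρ i ≡ i
ext-id ρ≗id zero    = refl
ext-id ρ≗id (suc i) = cong suc (ρ≗id i)

renF-id : ∀ {n} {ρ : Fin n → Fin n} → (∀ i → ρ i ≡ i) → ∀ φ → renF ρ φ ≡ φ
renF-id ρ≗id ⊥'       = refl
renF-id ρ≗id (s ≐ t)  = cong₂ _≐_ (renT-id ρ≗id s) (renT-id ρ≗id t)
renF-id ρ≗id (s ⊑ t)  = cong₂ _⊑_ (renT-id ρ≗id s) (renT-id ρ≗id t)
renF-id ρ≗id (φ ⇒ ψ)  = cong₂ _⇒_ (renF-id ρ≗id φ) (renF-id ρ≗id ψ)
renF-id ρ≗id (φ ∧' ψ) = cong₂ _∧'_ (renF-id ρ≗id φ) (renF-id ρ≗id ψ)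
renF-id ρ≗id (φ ∨' ψ) = cong₂ _∨'_ (renF-id ρ≗id φ) (renF-id ρ≗id ψ)
renF-id ρ≗id (∀' φ)   = cong ∀' (renF-id (ext-id ρ≗id) φ)
renF-id ρ≗id (∃' φ)   = cong ∃' (renF-id (ext-id ρ≗id) φ)

subT-cong : ∀ {n m} {σ σ' : Fin n → Term m} → (∀ i → σ i ≡ σ' i) → ∀ t → subT σ t ≡ subT σ' t
subT-cong σ≗σ' (var i) = σ≗σ' i
subT-cong σ≗σ' a       = refl
subT-cong σ≗σ' b       = refl
subT-cong σ≗σ' (s ∙ t) = cong₂ _∙_ (subT-cong σ≗σ' s) (subT-cong σ≗σ' t)

exts-cong : ∀ {n m} {σ σ' : Fin n → Term m} → (∀ i → σ i ≡ σ' i) → ∀ i → exts σ i ≡ exts σ' i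
exts-cong σ≗σ' zero    = refl
exts-cong σ≗σ' (suc i) = cong wkT (σ≗σ' i)

subF-cong : ∀ {n m} {σ σ' : Fin n → Term m} → (∀ i → σ i ≡ σ' i) → ∀ φ → subF σ φ ≡ subF σ' φ
subF-cong σ≗σ' ⊥'       = refl
subF-cong σ≗σ' (s ≐ t)  = cong₂ _≐_ (subT-cong σ≗σ' s) (subT-cong σ≗σ' t)
subF-cong σ≗σ' (s ⊑ t)  = cong₂ _⊑_ (subT-cong σ≗σ' s) (subT-cong σ≗σ' t)
subF-cong σ≗σ' (φ ⇒ ψ)  = cong₂ _⇒_ (subF-cong σ≗σ' φ) (subF-cong σ≗σ' ψ)
subF-cong σ≗σ' (φ ∧' ψ) = cong₂ _∧'_ (subF-cong σ≗σ' φ) (subF-cong σ≗σ' ψ)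
subF-cong σ≗σ' (φ ∨' ψ) = cong₂ _∨'_ (subF-cong σ≗σ' φ) (subF-cong σ≗σ' ψ)
subF-cong σ≗σ' (∀' φ)   = cong ∀' (subF-cong (exts-cong σ≗σ') φ)
subF-cong σ≗σ' (∃' φ)   = cong ∃' (subF-cong (exts-cong σ≗σ') φ)

subT-var : ∀ {n} (t : Term n) → subT var t ≡ t
subT-var (var i) = refl
subT-var a       = refl
subT-var b       = refl
subT-var (s ∙ t) = cong₂ _∙_ (subT-var s) (subT-var t)

subT-renT : ∀ {n m k} (σ : Fin m → Term k) (ρ : Fin n → Fin m) t →
            subT σ (renT ρ t) ≡ subT (σ ∘ ρ) t
subT-renT σ ρ (var i) = refl
subT-renT σ ρ a       = refl
subT-renT σ ρ b       = refl
subT-renT σ ρ (s ∙ t) = cong₂ _∙_ (subT-renT σ ρ s) (subT-renT σ ρ t)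

renT-subT : ∀ {n m k} (ρ : Fin m → Fin k) (σ : Fin n → Term m) t →
            renT ρ (subT σ t) ≡ subT (renT ρ ∘ σ) t
renT-subT ρ σ (var i) = refl
renT-subT ρ σ a       = refl
renT-subT ρ σ b       = refl
renT-subT ρ σ (s ∙ t) = cong₂ _∙_ (renT-subT ρ σ s) (renT-subT ρ σ t)

subT-subT : ∀ {n m k} (σ : Fin m → Term k) (σ' : Fin n → Term m) t →
            subT σ (subT σ' t) ≡ subT (subT σ ∘ σ') t
subT-subT σ σ' (var i) = refl
subT-subT σ σ' a       = refl
subT-subT σ σ' b       = refl
subT-subT σ σ' (s ∙ t) = cong₂ _∙_ (subT-subT σ σ' s) (subT-subT σ σ' t)

single-wkT : ∀ {n} (s t : Term n) → subT (single s) (wkT t) ≡ t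
single-wkT s t = trans (subT-renT (single s) suc t) (subT-var t)

exts-wkT : ∀ {n m} (σ : Fin n → Term m) t → subT (exts σ) (wkT t) ≡ wkT (subT σ t)
exts-wkT σ t = trans (subT-renT (exts σ) suc t) (sym (renT-subT suc σ t))

exts-subT : ∀ {n m k} (σ : Fin m → Term k) (σ' : Fin n → Term m) i →
            subT (exts σ) (exts σ' i) ≡ exts (subT σ ∘ σ') i
exts-subT σ σ' zero    = refl
exts-subT σ σ' (suc i) = exts-wkT σ (σ' i)

subF-subF : ∀ {n m k} (σ : Fin m → Term k) (σ' : Fin n → Term m) φ →
            subF σ (subF σ' φ) ≡ subF (subT σ ∘ σ') φ
subF-subF σ σ' ⊥'       = refl
subF-subF σ σ' (s ≐ t)  = cong₂ _≐_ (subT-subT σ σ' s) (subT-subT σ σ' t)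
subF-subF σ σ' (s ⊑ t)  = cong₂ _⊑_ (subT-subT σ σ' s) (subT-subT σ σ' t)
subF-subF σ σ' (φ ⇒ ψ)  = cong₂ _⇒_ (subF-subF σ σ' φ) (subF-subF σ σ' ψ)
subF-subF σ σ' (φ ∧' ψ) = cong₂ _∧'_ (subF-subF σ σ' φ) (subF-subF σ σ' ψ)
subF-subF σ σ' (φ ∨' ψ) = cong₂ _∨'_ (subF-subF σ σ' φ) (subF-subF σ σ' ψ)
subF-subF σ σ' (∀' φ)   =
  cong ∀' (trans (subF-subF (exts σ) (exts σ') φ) (subF-cong (exts-subT σ σ') φ))
subF-subF σ σ' (∃' φ)   =
  cong ∃' (trans (subF-subF (exts σ) (exts σ') φ) (subF-cong (exts-subT σ σ') φ))

renT-as-subT : ∀ {n m} (ρ : Fin n → Fin m) t → renT ρ t ≡ subT (var ∘ ρ) t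
renT-as-subT ρ (var i) = refl
renT-as-subT ρ a       = refl
renT-as-subT ρ b       = refl
renT-as-subT ρ (s ∙ t) = cong₂ _∙_ (renT-as-subT ρ s) (renT-as-subT ρ t)

ext-as-exts : ∀ {n m} (ρ : Fin n → Fin m) i → var (ext ρ i) ≡ exts (var ∘ ρ) i
ext-as-exts ρ zero    = refl
ext-as-exts ρ (suc i) = refl

renF-as-subF : ∀ {n m} (ρ : Fin n → Fin m) φ → renF ρ φ ≡ subF (var ∘ ρ) φ
renF-as-subF ρ ⊥'       = refl
renF-as-subF ρ (s ≐ t)  = cong₂ _≐_ (renT-as-subT ρ s) (renT-as-subT ρ t)
renF-as-subF ρ (s ⊑ t)  = cong₂ _⊑_ (renT-as-subT ρ s) (renT-as-subT ρ t)
renF-as-subF ρ (φ ⇒ ψ)  = cong₂ _⇒_ (renF-as-subF ρ φ) (renF-as-subF ρ ψ)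
renF-as-subF ρ (φ ∧' ψ) = cong₂ _∧'_ (renF-as-subF ρ φ) (renF-as-subF ρ ψ)
renF-as-subF ρ (φ ∨' ψ) = cong₂ _∨'_ (renF-as-subF ρ φ) (renF-as-subF ρ ψ)
renF-as-subF ρ (∀' φ)   =
  cong ∀' (trans (renF-as-subF (ext ρ) φ) (subF-cong (ext-as-exts ρ) φ))
renF-as-subF ρ (∃' φ)   =
  cong ∃' (trans (renF-as-subF (ext ρ) φ) (subF-cong (ext-as-exts ρ) φ))

renT-cl : ∀ {n m} (ρ : Fin n → Fin m) (t : Term 0) → renT ρ (cl t) ≡ cl t
renT-cl ρ (var ())
renT-cl ρ a       = refl
renT-cl ρ b       = refl
renT-cl ρ (s ∙ t) = cong₂ _∙_ (renT-cl ρ s) (renT-cl ρ t)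

subT-cl : ∀ {n m} (σ : Fin n → Term m) (t : Term 0) → subT σ (cl t) ≡ cl t
subT-cl σ (var ())
subT-cl σ a       = refl
subT-cl σ b       = refl
subT-cl σ (s ∙ t) = cong₂ _∙_ (subT-cl σ s) (subT-cl σ t)

clF-closed : (φ : Formula 0) → clF φ ≡ φ
clF-closed = renF-id (λ ())

subF-⊆p : ∀ {n m} (σ : Fin n → Term m) (x y : Term n) →
          subF σ (x ⊆p y) ≡ (subT σ x ⊆p subT σ y)
subF-⊆p σ x y
  rewrite exts-wkT (exts σ) (wkT x) | exts-wkT (exts σ) (wkT y)
        | exts-wkT σ x | exts-wkT σ y = refl

infixl 5 _,,_
_,,_ : ∀ {k n} → (Fin k → Term n) → Term n → Fin (suc k) → Term n
(σ ,, t) zero    = t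
(σ ,, t) (suc i) = σ i

noSub : ∀ {n} → Fin 0 → Term n
noSub ()

module _ {T : Theory} {n : ℕ} {Γ : List (Formula n)} where

  ≐subst-≡ : ∀ {s t ψ χ} (φ : Formula (suc n)) → φ [ s ] ≡ ψ → φ [ t ] ≡ χ →
             T ⊢ Γ ∣ s ≐ t → T ⊢ Γ ∣ ψ → T ⊢ Γ ∣ χ
  ≐subst-≡ φ refl refl = ≐subst φ

  ≐-sym : ∀ {s t} → T ⊢ Γ ∣ s ≐ t → T ⊢ Γ ∣ t ≐ s
  ≐-sym {s} {t} s≐t =
    ≐subst-≡ (var zero ≐ wkT s)
      (cong (s ≐_) (single-wkT s s)) (cong (t ≐_) (single-wkT t s)) s≐t (≐refl s)

  ≐-trans : ∀ {s t u} → T ⊢ Γ ∣ s ≐ t → T ⊢ Γ ∣ t ≐ u → T ⊢ Γ ∣ s ≐ u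
  ≐-trans {s} {t} {u} s≐t t≐u =
    ≐subst-≡ (wkT s ≐ var zero)
      (cong (_≐ t) (single-wkT t s)) (cong (_≐ u) (single-wkT u s)) t≐u s≐t

  ∙-congˡ : ∀ {s s' u} → T ⊢ Γ ∣ s ≐ s' → T ⊢ Γ ∣ s ∙ u ≐ s' ∙ u
  ∙-congˡ {s} {s'} {u} s≐s' =
    ≐subst-≡ (wkT (s ∙ u) ≐ var zero ∙ wkT u)
      (cong₂ _≐_ (single-wkT s (s ∙ u)) (cong (s ∙_) (single-wkT s u)))
      (cong₂ _≐_ (single-wkT s' (s ∙ u)) (cong (s' ∙_) (single-wkT s' u)))
      s≐s' (≐refl (s ∙ u))

  ∙-congʳ : ∀ {u s s'} → T ⊢ Γ ∣ s ≐ s' → T ⊢ Γ ∣ u ∙ s ≐ u ∙ s'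
  ∙-congʳ {u} {s} {s'} s≐s' =
    ≐subst-≡ (wkT (u ∙ s) ≐ wkT u ∙ var zero)
      (cong₂ _≐_ (single-wkT s (u ∙ s)) (cong (_∙ s) (single-wkT s u)))
      (cong₂ _≐_ (single-wkT s' (u ∙ s)) (cong (_∙ s') (single-wkT s' u)))
      s≐s' (≐refl (u ∙ s))

  ⊆p-refl : ∀ {s} → T ⊢ Γ ∣ s ⊆p s
  ⊆p-refl {s} = ∨I₁ (≐refl s)

  ⊆p-prefix : ∀ {s w} → T ⊢ Γ ∣ s ⊆p s ∙ w
  ⊆p-prefix {s} {w} = ∨I₂ (∨I₁ (∃I w
    (subst₂ (λ x y → T ⊢ Γ ∣ x ∙ y ≐ x ∙ w)
      (sym (single-wkT w s)) (sym (single-wkT w w)) (≐refl (s ∙ w)))))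

  ⊆p-suffix : ∀ {s w} → T ⊢ Γ ∣ s ⊆p w ∙ s
  ⊆p-suffix {s} {w} = ∨I₂ (∨I₂ (∨I₁ (∃I w
    (subst₂ (λ x y → T ⊢ Γ ∣ x ∙ y ≐ w ∙ y)
      (sym (single-wkT w w)) (sym (single-wkT w s)) (≐refl (w ∙ s))))))

  ⊆p-closed-subF : ∀ {k} (σ : Fin k → Term n) (x : Term k) (t : Term 0) →
                   T ⊢ Γ ∣ subT σ x ⊆p cl t → T ⊢ Γ ∣ subF σ (x ⊆p cl t)
  ⊆p-closed-subF σ x t =
    subst (T ⊢ Γ ∣_) (sym (trans (subF-⊆p σ x (cl t)) (cong (subT σ x ⊆p_) (subT-cl σ t))))

  ∀E-subF : ∀ {k} (σ : Fin k → Term n) {φ} → T ⊢ Γ ∣ subF σ (∀' φ) → (t : Term n) →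
            T ⊢ Γ ∣ subF (σ ,, t) φ
  ∀E-subF σ {φ} ∀φ t =
    subst (T ⊢ Γ ∣_) (trans (subF-subF (single t) (exts σ) φ) (subF-cong single-exts φ))
      (∀E ∀φ t)
    where
    single-exts : ∀ i → subT (single t) (exts σ i) ≡ (σ ,, t) i
    single-exts zero    = refl
    single-exts (suc i) = single-wkT t (σ i)

  axiom : ∀ {ψ} → T ψ → T ⊢ Γ ∣ subF noSub ψ
  axiom {ψ} Tψ =
    subst (T ⊢ Γ ∣_) (trans (renF-as-subF noVar ψ) (subF-cong (λ ()) ψ)) (ax Tψ)

  axiom₂ : ∀ {ψ} → T (∀' (∀' ψ)) → (x y : Term n) → T ⊢ Γ ∣ subF (noSub ,, x ,, y) ψ
  axiom₂ Tψ x y = ∀E-subF _ (∀E-subF noSub (axiom Tψ) x) y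

  axiom₃ : ∀ {ψ} → T (∀' (∀' (∀' ψ))) → (x y z : Term n) →
           T ⊢ Γ ∣ subF (noSub ,, x ,, y ,, z) ψ
  axiom₃ Tψ x y z = ∀E-subF _ (∀E-subF _ (∀E-subF noSub (axiom Tψ) x) y) z

v0 : ∀ {n} → Term (suc n)
v0 = var zero

v1 : ∀ {n} → Term (suc (suc n))
v1 = var (suc zero)

v2 : ∀ {n} → Term (suc (suc (suc n)))
v2 = var (suc (suc zero))

module _ {n : ℕ} {Γ : List (Formula n)} where

  ∙-assoc : ∀ X Y Z → WQT* ⊢ Γ ∣ cl X ∙ (cl Y ∙ cl Z) ≐ (cl X ∙ cl Y) ∙ cl Z
  ∙-assoc X Y Z = ⇒E (axiom₃ (wqt*1 t) (cl X) (cl Y) (cl Z))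
    (∨I₁ (⊆p-closed-subF (noSub ,, cl X ,, cl Y ,, cl Z) (v2 ∙ (v1 ∙ v0)) t ⊆p-refl))
    where t = X ∙ (Y ∙ Z)

  ∙≢a×∙≢b : ∀ X Y → WQT* ⊢ Γ ∣ ¬' (cl X ∙ cl Y ≐ a) ∧' ¬' (cl X ∙ cl Y ≐ b)
  ∙≢a×∙≢b X Y = ⇒E (axiom₂ (wqt*2 t) (cl X) (cl Y))
    (⊆p-closed-subF (noSub ,, cl X ,, cl Y) (v1 ∙ v0) t ⊆p-refl)
    where t = X ∙ Y

  a∙-cancel : ∀ X Y → WQT* ⊢ Γ ∣ a ∙ cl X ≐ a ∙ cl Y → WQT* ⊢ Γ ∣ cl X ≐ cl Y
  a∙-cancel X Y = ⇒E (⇒E (∧E₁ (axiom₂ (wqt*3 t) (cl X) (cl Y)))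
    (∧I (⊆p-closed-subF σ (a ∙ v1) t ⊆p-prefix) (⊆p-closed-subF σ (a ∙ v0) t ⊆p-suffix)))
    where
    t = (a ∙ X) ∙ (a ∙ Y)
    σ = noSub ,, cl X ,, cl Y

  b∙-cancel : ∀ X Y → WQT* ⊢ Γ ∣ b ∙ cl X ≐ b ∙ cl Y → WQT* ⊢ Γ ∣ cl X ≐ cl Y
  b∙-cancel X Y = ⇒E (⇒E (∧E₁ (∧E₂ (axiom₂ (wqt*3 t) (cl X) (cl Y))))
    (∧I (⊆p-closed-subF σ (b ∙ v1) t ⊆p-prefix) (⊆p-closed-subF σ (b ∙ v0) t ⊆p-suffix)))
    where
    t = (b ∙ X) ∙ (b ∙ Y)
    σ = noSub ,, cl X ,, cl Y

  a∙≢b∙ : ∀ X Y → WQT* ⊢ Γ ∣ a ∙ cl X ≐ b ∙ cl Y → WQT* ⊢ Γ ∣ ⊥'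
  a∙≢b∙ X Y = ⇒E (⇒E (∧E₁ (axiom₂ (wqt*4 t) (cl X) (cl Y)))
    (∧I (⊆p-closed-subF σ (a ∙ v1) t ⊆p-prefix) (⊆p-closed-subF σ (b ∙ v0) t ⊆p-suffix)))
    where
    t = (a ∙ X) ∙ (b ∙ Y)
    σ = noSub ,, cl X ,, cl Y

  a≢b : WQT* ⊢ Γ ∣ a ≐ b → WQT* ⊢ Γ ∣ ⊥'
  a≢b a≐b = a∙≢b∙ a a (∙-congˡ a≐b)

data Letter : Set where
  ℓa ℓb : Letter

letter : Letter → Term 0
letter ℓa = a
letter ℓb = b

word : Letter → List Letter → Term 0
word c []      = letter c
word c (d ∷ w) = letter c ∙ word d w

word⁺ : List⁺ Letter → Term 0
word⁺ (c ∷ w) = word c w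

letters : Term 0 → List⁺ Letter
letters (var ())
letters a       = ℓa ∷ []
letters b       = ℓb ∷ []
letters (s ∙ t) = letters s ⁺++⁺ letters t

module _ {n : ℕ} {Γ : List (Formula n)} where

  word⁺-⁺++⁺ : ∀ u v → WQT* ⊢ Γ ∣ cl (word⁺ u) ∙ cl (word⁺ v) ≐ cl (word⁺ (u ⁺++⁺ v))
  word⁺-⁺++⁺ (c ∷ w) v = word-⁺++⁺ c w
    where
    word-⁺++⁺ : ∀ c w → WQT* ⊢ Γ ∣ cl (word c w) ∙ cl (word⁺ v) ≐ cl (word⁺ ((c ∷ w) ⁺++⁺ v))
    word-⁺++⁺ c []      = ≐refl _
    word-⁺++⁺ c (d ∷ w) =
      ≐-trans (≐-sym (∙-assoc (letter c) (word d w) (word⁺ v))) (∙-congʳ (word-⁺++⁺ d w))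

  ≐-word-letters : ∀ X → WQT* ⊢ Γ ∣ cl X ≐ cl (word⁺ (letters X))
  ≐-word-letters (var ())
  ≐-word-letters a       = ≐refl a
  ≐-word-letters b       = ≐refl b
  ≐-word-letters (s ∙ t) =
    ≐-trans (∙-congˡ (≐-word-letters s))
      (≐-trans (∙-congʳ (≐-word-letters t)) (word⁺-⁺++⁺ (letters s) (letters t)))

  letter≢∙ : ∀ c X Y → WQT* ⊢ Γ ∣ cl X ∙ cl Y ≐ cl (letter c) → WQT* ⊢ Γ ∣ ⊥'
  letter≢∙ ℓa X Y = ⇒E (∧E₁ (∙≢a×∙≢b X Y))
  letter≢∙ ℓb X Y = ⇒E (∧E₂ (∙≢a×∙≢b X Y))

word-≢ : ∀ c w d w' → (c ∷ w) ≢ (d ∷ w') → ∀ {n} {Γ : List (Formula n)} →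
         WQT* ⊢ Γ ∣ cl (word c w) ≐ cl (word d w') → WQT* ⊢ Γ ∣ ⊥'
word-≢ ℓa [] ℓa [] u≢v = ⊥-elim (u≢v refl)
word-≢ ℓb [] ℓb [] u≢v = ⊥-elim (u≢v refl)
word-≢ ℓa [] ℓb [] u≢v = a≢b
word-≢ ℓb [] ℓa [] u≢v = a≢b ∘ ≐-sym
word-≢ c [] d (e ∷ w) u≢v = letter≢∙ c (letter d) (word e w) ∘ ≐-sym
word-≢ c (e ∷ w) d [] u≢v = letter≢∙ d (letter c) (word e w)
word-≢ ℓa (e ∷ w) ℓa (f ∷ w') u≢v =
  word-≢ e w f w' (u≢v ∘ cong (ℓa ∷⁺_)) ∘ a∙-cancel (word e w) (word f w')
word-≢ ℓb (e ∷ w) ℓb (f ∷ w') u≢v =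
  word-≢ e w f w' (u≢v ∘ cong (ℓb ∷⁺_)) ∘ b∙-cancel (word e w) (word f w')
word-≢ ℓa (e ∷ w) ℓb (f ∷ w') u≢v = a∙≢b∙ (word e w) (word f w')
word-≢ ℓb (e ∷ w) ℓa (f ∷ w') u≢v = a∙≢b∙ (word f w') (word e w) ∘ ≐-sym

word⁺-≢ : ∀ u v → u ≢ v → ∀ {n} {Γ : List (Formula n)} →
          WQT* ⊢ Γ ∣ cl (word⁺ u) ≐ cl (word⁺ v) → WQT* ⊢ Γ ∣ ⊥'
word⁺-≢ (c ∷ w) (d ∷ w') = word-≢ c w d w'

τ-letters : LTerm → List Letter
τ-letters = toList ∘ letters ∘ τ

τ-letters-prefix-free : ∀ u v {r r'} → τ-letters u ++ r ≡ τ-letters v ++ r' → u ≡ v × r ≡ r'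
τ-letters-prefix-free 𝟎          𝟎          eq = refl , ∷-injectiveʳ eq
τ-letters-prefix-free (pair u₁ u₂) (pair v₁ v₂) {r} {r'} eq
  with τ-letters-prefix-free u₁ v₁
         (trans (sym (++-assoc (τ-letters u₁) (τ-letters u₂) r))
           (trans (∷-injectiveʳ eq) (++-assoc (τ-letters v₁) (τ-letters v₂) r')))
... | refl , eq₂ with τ-letters-prefix-free u₂ v₂ eq₂
...   | refl , r≡r' = refl , r≡r'

letters-τ-injective : ∀ u v → letters (τ u) ≡ letters (τ v) → u ≡ v
letters-τ-injective u v eq = proj₁ (τ-letters-prefix-free u v
  (trans (++-identityʳ (τ-letters u)) (trans (cong toList eq) (sym (++-identityʳ (τ-letters v))))))

AxiomsDerivable : Theory → Theory → Set
AxiomsDerivable T T' = ∀ {n} {Γ : List (Formula n)} ψ → T ψ → T' ⊢ Γ ∣ clF ψ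

⊢-transfer : ∀ {T T'} → AxiomsDerivable T T' →
             ∀ {n} {Γ : List (Formula n)} {φ} → T ⊢ Γ ∣ φ → T' ⊢ Γ ∣ φ
⊢-transfer T⊆T' (hyp φ∈Γ)     = hyp φ∈Γ
⊢-transfer T⊆T' (ax Tψ)       = T⊆T' _ Tψ
⊢-transfer T⊆T' (raa d)       = raa (⊢-transfer T⊆T' d)
⊢-transfer T⊆T' (⇒I d)        = ⇒I (⊢-transfer T⊆T' d)
⊢-transfer T⊆T' (⇒E d e)      = ⇒E (⊢-transfer T⊆T' d) (⊢-transfer T⊆T' e)
⊢-transfer T⊆T' (∧I d e)      = ∧I (⊢-transfer T⊆T' d) (⊢-transfer T⊆T' e)
⊢-transfer T⊆T' (∧E₁ d)       = ∧E₁ (⊢-transfer T⊆T' d)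
⊢-transfer T⊆T' (∧E₂ d)       = ∧E₂ (⊢-transfer T⊆T' d)
⊢-transfer T⊆T' (∨I₁ d)       = ∨I₁ (⊢-transfer T⊆T' d)
⊢-transfer T⊆T' (∨I₂ d)       = ∨I₂ (⊢-transfer T⊆T' d)
⊢-transfer T⊆T' (∨E d e f)    = ∨E (⊢-transfer T⊆T' d) (⊢-transfer T⊆T' e) (⊢-transfer T⊆T' f)
⊢-transfer T⊆T' (∀I d)        = ∀I (⊢-transfer T⊆T' d)
⊢-transfer T⊆T' (∀E d t)      = ∀E (⊢-transfer T⊆T' d) t
⊢-transfer T⊆T' (∃I t d)      = ∃I t (⊢-transfer T⊆T' d)
⊢-transfer T⊆T' (∃E d e)      = ∃E (⊢-transfer T⊆T' d) (⊢-transfer T⊆T' e)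
⊢-transfer T⊆T' (≐refl t)     = ≐refl t
⊢-transfer T⊆T' (≐subst φ d e) = ≐subst φ (⊢-transfer T⊆T' d) (⊢-transfer T⊆T' e)

WQT*-derives-WQT : AxiomsDerivable WQT WQT*
WQT*-derives-WQT _ (wqt1 u v τu≢τv) = ⇒I (word⁺-≢ (letters (τ u)) (letters (τ v))
  (τu≢τv ∘ cong τ ∘ letters-τ-injective u v)
  (≐-trans (≐-sym (≐-word-letters (τ u))) (≐-trans (hyp (here refl)) (≐-word-letters (τ v)))))
WQT*-derives-WQT {n} {Γ} _ (wqt2 u v) =
  subst (WQT* ⊢ Γ ∣_) (cong₂ decomposition (cl-under-∀ (τ u)) (cl-under-∀ (τ v)))
    (⇒E (axiom₂ (wqt*6 t) (cl (τ u)) (cl (τ v)))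
        (⊆p-closed-subF (noSub ,, cl (τ u) ,, cl (τ v)) (b ∙ (v1 ∙ v0)) t ⊆p-refl))
  where
  t = b ∙ (τ u ∙ τ v)
  decomposition : Term (suc n) → Term (suc n) → Formula n
  decomposition s r = ∀' (v0 ⊑ b ∙ (s ∙ r) ⇔ (v0 ≐ b ∙ (s ∙ r)) ∨' (v0 ⊑ s) ∨' (v0 ⊑ r))
  cl-under-∀ : ∀ X → wkT {n} (cl X) ≡ renT (ext noVar) (cl {1} X)
  cl-under-∀ X = trans (renT-cl suc X) (sym (renT-cl (ext noVar) X))
WQT*-derives-WQT _ wqt3 = ax wqt*7

mainTheorem10 : ((φ : Formula 0) → WQT φ → Provable WQT* φ)
    × ((φ : Formula 0) → Provable WQT φ → Provable WQT* φ)
mainTheorem10 =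
  (λ φ WQTφ → subst (WQT* ⊢ [] ∣_) (clF-closed φ) (WQT*-derives-WQT φ WQTφ)) ,
  (λ φ → ⊢-transfer WQT*-derives-WQT)
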